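{- If $T$ is a tree of order at least $7$ which is $r$-regular for some $r$, with $\Delta(T)=3^{2p+1}-2$ for some positive integer $p$, then $\chi'_g(T)\geq\Delta(T)+3$.
   Context: For an integer $r\geq 2$, a tree is $r$-regular if each of its non-leaf vertices has degree $r$. For an Abelian group $\mathcal{G}$ (written additively), a $\mathcal{G}$-twin edge coloring of a graph $G$ is a proper edge labeling $f:E(G)\to\mathcal{G}$ such that the weighted degrees $w(v)=\sum_{u\in N(v)}f(uv)$ satisfy $w(u)\neq w(v)$ for every edge $uv$. The group twin chromatic index $\chi'_g(G)$ is the least integer $k\geq 2$ such that $G$ has a $\mathcal{G}$-twin edge coloring for every Abelian group $\mathcal{G}$ of order $k$. $\Delta(T)$ denotes maximum degree. -}

module Defs where

open import Data.Nat using (ℕ; zero; suc; _+_; _*_; _∸_; _^_; _≤_; _<_; _⊔_)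
open import Data.Fin using (Fin)
open import Data.Bool using (Bool; true; false; if_then_else_)
open import Data.List using (List; []; _∷_; _++_; [_]; length; foldr; map; allFin; filterᵇ)
open import Data.List.Relation.Unary.Unique.Propositional using (Unique)
open import Data.List.Relation.Unary.Linked using (Linked)
open import Data.Product using (Σ; ∃; _×_; _,_)
open import Relation.Nullary using (¬_)
open import Relation.Binary.PropositionalEquality using (_≡_; _≢_)
open import Algebra.Core using (Op₁; Op₂)
open import Algebra.Structures using (IsAbelianGroup)

record Graph (n : ℕ) : Set where
  field
    adj   : Fin n → Fin n → Bool
    sym   : ∀ u v → adj u v ≡ adj v u
    irref : ∀ v → adj v v ≡ false
open Graph public

module _ {n : ℕ} (G : Graph n) where

  Adj : Fin n → Fin n → Set
  Adj u v = adj G u v ≡ true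

  data Walk : Fin n → Fin n → Set where
    here : ∀ {u} → Walk u u
    step : ∀ {u w v} → Adj u w → Walk w v → Walk u v

  Connected : Set
  Connected = ∀ u v → Walk u v

  IsCycle : List (Fin n) → Set
  IsCycle []       = ¬ (0 ≡ 0)
  IsCycle (v ∷ vs) = Unique (v ∷ vs) × 3 ≤ length (v ∷ vs) × Linked Adj ((v ∷ vs) ++ [ v ])

  Acyclic : Set
  Acyclic = ∀ c → ¬ IsCycle c

  IsTree : Set
  IsTree = Connected × Acyclic

  degree : Fin n → ℕ
  degree v = length (filterᵇ (adj G v) (allFin n))

  maxDegree : ℕ
  maxDegree = foldr _⊔_ 0 (map degree (allFin n))

  IsRegularTree : ℕ → Set
  IsRegularTree r = 2 ≤ r × IsTree × (∀ v → ¬ (degree v ≡ 1) → degree v ≡ r)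

-- An Abelian group of order k, represented (up to isomorphism) with carrier Fin k.
record FinAbGroup (k : ℕ) : Set where
  field
    _∙_   : Op₂ (Fin k)
    ε     : Fin k
    _⁻¹   : Op₁ (Fin k)
    isAbelianGroup : IsAbelianGroup _≡_ _∙_ ε _⁻¹

module _ {n k : ℕ} (G : Graph n) (A : FinAbGroup k) where
  open FinAbGroup A

  weight : (Fin n → Fin n → Fin k) → Fin n → Fin k
  weight f v = foldr (λ u acc → (if adj G v u then f v u else ε) ∙ acc) ε (allFin n)

  -- f is an edge labelling (values on non-edges are irrelevant), proper,
  -- and adjacent vertices have distinct weighted degrees
  IsTwinEdgeColoring : (Fin n → Fin n → Fin k) → Set
  IsTwinEdgeColoring f =
    (∀ u v → Adj G u v → f u v ≡ f v u) ×
    (∀ v u w → Adj G v u → Adj G v w → u ≢ w → f v u ≢ f v w) ×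
    (∀ u v → Adj G u v → weight f u ≢ weight f v)

  HasTwinEdgeColoring : Set
  HasTwinEdgeColoring = ∃ IsTwinEdgeColoring

TwinColorableAllGroups : {n : ℕ} → Graph n → ℕ → Set
TwinColorableAllGroups G k = (A : FinAbGroup k) → HasTwinEdgeColoring G A

IsGroupTwinChromaticIndex : {n : ℕ} → Graph n → ℕ → Set
IsGroupTwinChromaticIndex G k =
  2 ≤ k × TwinColorableAllGroups G k ×
  (∀ j → 2 ≤ j → j < k → ¬ TwinColorableAllGroups G j)

-- Say that a finite abelian group contains its own Δ-sums if every Δ distinct
-- elements include their sum.  Take a twin edge coloring with labels in such a
-- group, of a tree whose non-leaf vertices have degree Δ.  Each vertex v of
-- degree Δ has an edge vu labelled w(v); u is no leaf (its weight would be
-- f(uv) = w(v)), and the same choice at u does not lead back to v (else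
-- w(u) = f(uv) = w(v)).  This yields an infinite non-backtracking walk, hence a
-- cycle.  So it suffices to find such a group of every order k ≤ Δ + 2.  A Δ-set
-- contains its sum s unless s lies in its complement C, where s + ΣC is the total
-- sum: for k ≤ Δ, C is empty; for k = Δ + 1 = 2m with m odd, ℤ/k works, as its
-- total sum m is not of the form c + c; for k = Δ + 2 = 3^t, (ℤ/3)^t works, as its
-- total sum is 0 and a + a + b = 0 forces a = b.  The value Δ = 3^(2p+1) − 2
-- makes Δ + 1 twice an odd number and Δ + 2 a power of 3.
module Submission where

open import Defs renaming (sym to adj-sym)
open import Algebra.Bundles using (AbelianGroup)
open import Algebra.Structures using (IsAbelianGroup)
import Algebra.Properties.AbelianGroup as AbelianGroupProperties
import Algebra.Properties.Group as GroupProperties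
open import Data.Bool using (true; false; if_then_else_; T; T?)
open import Data.Bool.Properties using (T-≡)
open import Data.Empty using (⊥-elim)
open import Data.Fin using (Fin; zero; suc; toℕ; combine; remQuot)
open import Data.Fin.Properties using (_≟_; toℕ-injective; toℕ-fromℕ<; toℕ<n; remQuot-combine; combine-remQuot; pigeonhole)
open import Data.List using (List; []; _∷_; _++_; [_]; length; foldr; map; filter; filterᵇ; allFin; tabulate; applyUpTo; upTo; _∷ʳ_)
open import Data.List.Properties using (length-map; length-++; length-tabulate; map-tabulate; applyUpTo-∷ʳ; upTo-∷ʳ)
open import Data.List.Membership.Propositional using (_∈_; _∉_)
open import Data.List.Membership.Propositional.Properties using (∈-allFin; ∈-filter⁺; ∈-filter⁻; ∈-map⁺; ∈-map⁻; ∈-++⁺ˡ; ∈-++⁺ʳ)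
open import Data.List.Membership.Propositional.Properties.WithK using (unique∧set⇒bag)
open import Data.List.Relation.Binary.BagAndSetEquality using (∼bag⇒↭)
open import Data.List.Relation.Binary.Permutation.Propositional using (_↭_; ↭⇒↭ₛ)
open import Data.List.Relation.Binary.Permutation.Propositional.Properties using (↭-length)
open import Data.List.Relation.Unary.All as All using ([]; _∷_)
open import Data.List.Relation.Unary.All.Properties using () renaming (map⁺ to All-map⁺)
open import Data.List.Relation.Unary.AllPairs using ([]; _∷_)
open import Data.List.Relation.Unary.Any using (here; there)
open import Data.List.Relation.Unary.Linked using (Linked; []; [-]; _∷_)
open import Data.List.Relation.Unary.Unique.Propositional using (Unique)
import Data.List.Relation.Unary.Unique.Propositional.Properties as Unique
open import Data.Nat using (ℕ; zero; suc; _+_; _*_; _∸_; _^_; _≤_; _<_; _⊔_; z≤n; s≤s)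
open import Data.Nat.DivMod using (_mod_; _%_; m%n<n; %-distribˡ-+; m%n%n≡m%n; m<n⇒m%n≡m; n%n≡0; [m+kn]%n≡m%n; m≡m%n+[m/n]*n; _/_)
open import Data.Nat.Induction using (<-rec)
open import Data.Nat.ListAction using () renaming (sum to sumℕ)
open import Data.Nat.ListAction.Properties using () renaming (sum-++ to sumℕ-++)
open import Data.Nat.Properties using (+-cancelʳ-≡; <⇒≱; m<m+n; m≤n⇒∃[o]m+o≡n; ≤-trans; n<1+n; +-comm; +-assoc; +-suc; +-identityʳ; +-cancelˡ-≡; *-cancelˡ-≡; m∸n+n≡m; m≤n+m; <⇒≤; ≤-pred; ≮⇒≥; <-cmp; ⊔-sel; ⊔-identityʳ; even≢odd; ≤-antisym)
open import Data.Nat.Tactic.RingSolver using (solve-∀)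
open import Data.Product using (Σ; ∃-syntax; _×_; _,_; proj₁; proj₂; uncurry)
open import Data.Sum using (_⊎_; inj₁; inj₂)
open import Function using (_∘_; id)
open import Function.Bundles using (mk⇔; Equivalence)
open import Relation.Binary.Definitions using (tri<; tri≈; tri>)
open import Relation.Binary.PropositionalEquality using (_≡_; _≢_; refl; sym; trans; cong; cong₂; subst; setoid; isEquivalence; module ≡-Reasoning)
open import Relation.Nullary using (¬_; ¬?; yes; no)
open ≡-Reasoning

tabulate-∘toℕ : ∀ {A : Set} n (f : ℕ → A) → tabulate {n = n} (f ∘ toℕ) ≡ applyUpTo f n
tabulate-∘toℕ zero    f = refl
tabulate-∘toℕ (suc n) f = cong (f 0 ∷_) (tabulate-∘toℕ n (f ∘ suc))

map-toℕ-allFin : ∀ n → map toℕ (allFin n) ≡ upTo n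
map-toℕ-allFin n = trans (map-tabulate id toℕ) (tabulate-∘toℕ n id)

sumℕ-upTo : ∀ n → 2 * sumℕ (upTo n) + n ≡ n * n
sumℕ-upTo zero    = refl
sumℕ-upTo (suc n) = begin
  2 * sumℕ (upTo (suc n)) + suc n       ≡⟨ cong (λ xs → 2 * sumℕ xs + suc n) (upTo-∷ʳ n) ⟨
  2 * sumℕ (upTo n ∷ʳ n) + suc n        ≡⟨ cong (λ s → 2 * s + suc n) (sumℕ-++ (upTo n) [ n ]) ⟩
  2 * (sumℕ (upTo n) + (n + 0)) + suc n ≡⟨ regroup (sumℕ (upTo n)) n ⟩
  (2 * sumℕ (upTo n) + n) + (2 * n + 1) ≡⟨ cong (_+ (2 * n + 1)) (sumℕ-upTo n) ⟩
  n * n + (2 * n + 1)                   ≡⟨ square-suc n ⟩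
  suc n * suc n                         ∎
  where
  regroup : ∀ s n → 2 * (s + (n + 0)) + suc n ≡ (2 * s + n) + (2 * n + 1)
  regroup = solve-∀
  square-suc : ∀ n → n * n + (2 * n + 1) ≡ suc n * suc n
  square-suc = solve-∀

sumℕ-upTo-even : ∀ m → sumℕ (upTo (2 * suc m)) ≡ suc m + m * (2 * suc m)
sumℕ-upTo-even m = *-cancelˡ-≡ _ _ 2 (+-cancelʳ-≡ (2 * suc m) _ _ (trans (sumℕ-upTo (2 * suc m)) (sym (square m))))
  where
  square : ∀ m → 2 * (suc m + m * (2 * suc m)) + 2 * suc m ≡ 2 * suc m * (2 * suc m)
  square = solve-∀

3^[2p+1]≡3+4q : ∀ p → ∃[ q ] 3 ^ (2 * p + 1) ≡ 3 + 4 * q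
3^[2p+3]≡3+4[1+q] : ∀ p → ∃[ q ] 3 ^ (2 * suc p + 1) ≡ 3 + 4 * suc q

3^[2p+1]≡3+4q zero    = 0 , refl
3^[2p+1]≡3+4q (suc p) = let q , eq = 3^[2p+3]≡3+4[1+q] p in suc q , eq

3^[2p+3]≡3+4[1+q] p with q , eq ← 3^[2p+1]≡3+4q p = 5 + 9 * q , (begin
  3 ^ (2 * suc p + 1)         ≡⟨ cong (3 ^_) (exponent p) ⟩
  3 * (3 * 3 ^ (2 * p + 1))   ≡⟨ cong (λ x → 3 * (3 * x)) eq ⟩
  3 * (3 * (3 + 4 * q))       ≡⟨ arithmetic q ⟩
  3 + 4 * suc (5 + 9 * q)     ∎)
  where
  exponent : ∀ p → 2 * suc p + 1 ≡ suc (suc (2 * p + 1))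
  exponent = solve-∀
  arithmetic : ∀ q → 3 * (3 * (3 + 4 * q)) ≡ 3 + 4 * suc (5 + 9 * q)
  arithmetic = solve-∀

foldr-⊔-∈ : ∀ x xs → foldr _⊔_ 0 (x ∷ xs) ∈ x ∷ xs
foldr-⊔-∈ x []       = here (⊔-identityʳ x)
foldr-⊔-∈ x (y ∷ ys) with ⊔-sel x (foldr _⊔_ 0 (y ∷ ys))
... | inj₁ max≡x = here max≡x
... | inj₂ max≡rest = there (subst (_∈ y ∷ ys) (sym max≡rest) (foldr-⊔-∈ y ys))

maxDegree-attained : ∀ {n} (G : Graph (suc n)) → ∃[ v ] degree G v ≡ maxDegree G
maxDegree-attained G
  with v , _ , eq ← ∈-map⁻ (degree G) (foldr-⊔-∈ (degree G zero) (map (degree G) (tabulate suc)))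
  = v , sym eq

map⁺-injectiveOn : ∀ {A B : Set} (f : A → B) {xs : List A} →
                   (∀ {x y} → x ∈ xs → y ∈ xs → x ≢ y → f x ≢ f y) →
                   Unique xs → Unique (map f xs)
map⁺-injectiveOn f         injective []           = []
map⁺-injectiveOn f {x ∷ _} injective (x∉xs ∷ xs!) =
  All-map⁺ (All.tabulate (λ y∈ → injective (here refl) (there y∈) (All.lookup x∉xs y∈)))
  ∷ map⁺-injectiveOn f (λ x∈ y∈ → injective (there x∈) (there y∈)) xs!

length≡1⇒≡[x] : ∀ {A : Set} {x : A} {xs : List A} → length xs ≡ 1 → x ∈ xs → xs ≡ [ x ]
length≡1⇒≡[x] {xs = _ ∷ []} _ (here refl) = refl

applyUpTo-linked : ∀ {A : Set} {R : A → A → Set} (h : ℕ → A) →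
                   (∀ t → R (h t) (h (suc t))) → ∀ d → Linked R (applyUpTo h d)
applyUpTo-linked h related zero          = []
applyUpTo-linked h related (suc zero)    = [-]
applyUpTo-linked h related (suc (suc d)) = related 0 ∷ applyUpTo-linked (h ∘ suc) (related ∘ suc) (suc d)

module _ {n : ℕ} (G : Graph n) where

  adj-irreflexive : ∀ v → ¬ Adj G v v
  adj-irreflexive v loop with () ← trans (sym loop) (irref G v)

  NonBacktrackingWalk : (ℕ → Fin n) → Set
  NonBacktrackingWalk w = ∀ t → Adj G (w t) (w (suc t)) × w (suc (suc t)) ≢ w t

  -- A shortest return w (i + suc d) = w i has distinct intermediate vertices,
  -- so it is a loop (d = 0), a backtrack (d = 1) or a cycle.
  nonBacktrackingWalk-noReturn : Acyclic G → ∀ {w} → NonBacktrackingWalk w →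
                                 ∀ d i → w (i + suc d) ≢ w i
  nonBacktrackingWalk-noReturn acyclic {w} walk = <-rec _ noShortestReturn
    where
    advance : ∀ i t → Adj G (w (i + t)) (w (i + suc t))
    advance i t = subst (Adj G (w (i + t))) (cong w (sym (+-suc i t))) (proj₁ (walk (i + t)))

    noShortestReturn : ∀ d → (∀ {e} → e < d → ∀ i → w (i + suc e) ≢ w i) →
                       ∀ i → w (i + suc d) ≢ w i
    noShortestReturn zero _ i return =
      adj-irreflexive (w i) (subst (Adj G (w i)) (trans (cong w (+-comm 1 i)) return) (proj₁ (walk i)))
    noShortestReturn (suc zero) _ i return =
      proj₂ (walk i) (trans (cong w (+-comm 2 i)) return)
    noShortestReturn d@(suc (suc _)) shorter i return =
      acyclic (applyUpTo h (suc d)) (distinct , s≤s (s≤s (s≤s z≤n)) , closed)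
      where
      h : ℕ → Fin n
      h a = w (i + a)
      distinct : Unique (applyUpTo h (suc d))
      distinct = Unique.applyUpTo⁺₁ h (suc d) λ {a} {b} a<b b<1+d ha≡hb →
        let e , 1+a+e≡b = m≤n⇒∃[o]m+o≡n a<b
            e<d = ≤-trans (subst (suc e ≤_) 1+a+e≡b (s≤s (m≤n+m e a))) (≤-pred b<1+d)
        in shorter e<d (i + a) (trans (cong w (trans (offset i a e) (cong (i +_) 1+a+e≡b))) (sym ha≡hb))
        where
        offset : ∀ i a e → i + a + suc e ≡ i + (suc a + e)
        offset = solve-∀
      closed : Linked (Adj G) (applyUpTo h (suc d) ++ [ h 0 ])
      closed = subst (λ v → Linked (Adj G) (applyUpTo h (suc d) ∷ʳ v))
                     (trans return (cong w (sym (+-identityʳ i))))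
                     (subst (Linked (Adj G)) (sym (applyUpTo-∷ʳ h (suc d)))
                            (applyUpTo-linked h (advance i) (suc (suc d))))

  acyclic⇒¬nonBacktrackingWalk : Acyclic G → ∀ w → ¬ NonBacktrackingWalk w
  acyclic⇒¬nonBacktrackingWalk acyclic w walk
    with i , j , i<j , wi≡wj ← pigeonhole (n<1+n n) (w ∘ toℕ)
    with d , 1+i+d≡j ← m≤n⇒∃[o]m+o≡n i<j
    = nonBacktrackingWalk-noReturn acyclic walk d (toℕ i) (trans (cong w (trans (+-suc (toℕ i) d) 1+i+d≡j)) (sym wi≡wj))

Exponent3 : ∀ {k} → FinAbGroup k → Set
Exponent3 A = ∀ x → x ∙ (x ∙ x) ≡ ε
  where open FinAbGroup A

module FinAbGroupSum {k : ℕ} (A : FinAbGroup k) where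
  open FinAbGroup A
  open IsAbelianGroup isAbelianGroup using (assoc; comm; identityˡ; identityʳ; inverseʳ; isCommutativeMonoid)
  private
    abelianGroup : AbelianGroup _ _
    abelianGroup = record { isAbelianGroup = isAbelianGroup }
  open AbelianGroupProperties abelianGroup using (⁻¹-∙-comm)
  open GroupProperties (AbelianGroup.group abelianGroup) using (ε⁻¹≈ε; ⁻¹-injective; ⁻¹-involutive; inverseʳ-unique)
  open import Data.List.Membership.DecPropositional (_≟_ {k}) using (_∈?_)
  open import Data.List.Relation.Binary.Permutation.Setoid.Properties (setoid (Fin k)) using (foldr-commMonoid)

  sum : List (Fin k) → Fin k
  sum = foldr _∙_ ε

  sum-++ : ∀ xs ys → sum (xs ++ ys) ≡ sum xs ∙ sum ys
  sum-++ []       ys = sym (identityˡ _)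
  sum-++ (x ∷ xs) ys = trans (cong (x ∙_) (sum-++ xs ys)) (sym (assoc x (sum xs) (sum ys)))

  sum-↭ : ∀ {xs ys} → xs ↭ ys → sum xs ≡ sum ys
  sum-↭ xs↭ys = foldr-commMonoid isCommutativeMonoid (↭⇒↭ₛ xs↭ys)

  sum-map-⁻¹ : ∀ xs → sum (map _⁻¹ xs) ≡ sum xs ⁻¹
  sum-map-⁻¹ []       = sym ε⁻¹≈ε
  sum-map-⁻¹ (x ∷ xs) = trans (cong (x ⁻¹ ∙_) (sum-map-⁻¹ xs)) (⁻¹-∙-comm x (sum xs))

  total : Fin k
  total = sum (allFin k)

  ↭-allFin : ∀ {xs} → Unique xs → (∀ x → x ∈ xs) → xs ↭ allFin k
  ↭-allFin xs! complete = ∼bag⇒↭ (unique∧set⇒bag xs! (Unique.allFin⁺ k) (mk⇔ (λ _ → ∈-allFin _) (λ _ → complete _)))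

  total⁻¹≡total : total ⁻¹ ≡ total
  total⁻¹≡total = trans (sym (sum-map-⁻¹ (allFin k))) (sum-↭ (↭-allFin (Unique.map⁺ ⁻¹-injective (Unique.allFin⁺ k)) inverse∈))
    where
    inverse∈ : ∀ x → x ∈ map _⁻¹ (allFin k)
    inverse∈ x = subst (_∈ map _⁻¹ (allFin k)) (⁻¹-involutive x) (∈-map⁺ _⁻¹ (∈-allFin (x ⁻¹)))

  exponent3⇒total≡ε : Exponent3 A → total ≡ ε
  exponent3⇒total≡ε cube = begin
    total                        ≡⟨ identityʳ total ⟨
    total ∙ ε                    ≡⟨ cong (total ∙_) (inverseʳ total) ⟨
    total ∙ (total ∙ (total ⁻¹)) ≡⟨ cong (λ x → total ∙ (total ∙ x)) total⁻¹≡total ⟩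
    total ∙ (total ∙ total)      ≡⟨ cube total ⟩
    ε                            ∎

  complement : List (Fin k) → List (Fin k)
  complement xs = filter (λ x → ¬? (x ∈? xs)) (allFin k)

  complement-unique : ∀ xs → Unique (complement xs)
  complement-unique xs = Unique.filter⁺ _ (Unique.allFin⁺ k)

  ∈⊎∈-complement : ∀ xs x → x ∈ xs ⊎ x ∈ complement xs
  ∈⊎∈-complement xs x with x ∈? xs
  ... | yes x∈xs = inj₁ x∈xs
  ... | no  x∉xs = inj₂ (∈-filter⁺ (λ x → ¬? (x ∈? xs)) (∈-allFin x) x∉xs)

  ++-complement-↭ : ∀ {xs} → Unique xs → xs ++ complement xs ↭ allFin k
  ++-complement-↭ {xs} xs! = ↭-allFin (Unique.++⁺ xs! (complement-unique xs) disjoint) complete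
    where
    disjoint : ∀ {x} → ¬ (x ∈ xs × x ∈ complement xs)
    disjoint (x∈xs , x∈compl) = proj₂ (∈-filter⁻ (λ x → ¬? (x ∈? xs)) {xs = allFin k} x∈compl) x∈xs
    complete : ∀ x → x ∈ xs ++ complement xs
    complete x with ∈⊎∈-complement xs x
    ... | inj₁ x∈xs    = ∈-++⁺ˡ x∈xs
    ... | inj₂ x∈compl = ∈-++⁺ʳ xs x∈compl

  sum∙sum-complement : ∀ {xs} → Unique xs → sum xs ∙ sum (complement xs) ≡ total
  sum∙sum-complement {xs} xs! = trans (sym (sum-++ xs (complement xs))) (sum-↭ (++-complement-↭ xs!))

  length+length-complement : ∀ {xs} → Unique xs → length xs + length (complement xs) ≡ k
  length+length-complement {xs} xs! =
    trans (sym (length-++ xs)) (trans (↭-length (++-complement-↭ xs!)) (length-tabulate id))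

  ContainsOwnSums : ℕ → Set
  ContainsOwnSums Δ = ∀ xs → Unique xs → length xs ≡ Δ → sum xs ∈ xs

  containsOwnSums-viaComplements : ∀ {Δ} →
    (∀ ys → Unique ys → Δ + length ys ≡ k → ∀ w → w ∙ sum ys ≡ total → w ∉ ys) →
    ContainsOwnSums Δ
  containsOwnSums-viaComplements {Δ} avoids xs xs! refl with ∈⊎∈-complement xs (sum xs)
  ... | inj₁ sum∈xs    = sum∈xs
  ... | inj₂ sum∈compl = ⊥-elim (avoids (complement xs) (complement-unique xs)
                           (length+length-complement xs!) (sum xs) (sum∙sum-complement xs!) sum∈compl)

  containsOwnSums-≥order : ∀ {Δ} → k ≤ Δ → ContainsOwnSums Δ
  containsOwnSums-≥order {Δ} k≤Δ = containsOwnSums-viaComplements λ where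
    []      _ _     _ _ ()
    (_ ∷ _) _ Δ+ys≡k _ _ _ → <⇒≱ (m<m+n Δ (s≤s z≤n)) (subst (_≤ Δ) (sym Δ+ys≡k) k≤Δ)

  containsOwnSums-exponent3 : Exponent3 A → ∀ {Δ} → Δ + 2 ≡ k → ContainsOwnSums Δ
  containsOwnSums-exponent3 cube {Δ} Δ+2≡k = containsOwnSums-viaComplements λ ys ys! Δ+ys≡k w w∙ys≡total →
    avoidsPair ys ys! (+-cancelˡ-≡ Δ _ _ (trans Δ+ys≡k (sym Δ+2≡k))) w (trans w∙ys≡total (exponent3⇒total≡ε cube))
    where
    cancel : ∀ a b → a ∙ (a ∙ b) ≡ ε → a ≡ b
    cancel a b a∙a∙b≡ε = trans (inverseʳ-unique (a ∙ a) a (trans (assoc a a a) (cube a)))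
                               (sym (inverseʳ-unique (a ∙ a) b (trans (assoc a a b) a∙a∙b≡ε)))
    avoidsPair : ∀ ys → Unique ys → length ys ≡ 2 → ∀ w → w ∙ sum ys ≡ ε → w ∉ ys
    avoidsPair (a ∷ b ∷ []) ((a≢b ∷ []) ∷ _) _ w w∙ab≡ε w∈ab = a≢b (collapse w∈ab)
      where
      a∙b≡sum : a ∙ b ≡ sum (a ∷ b ∷ [])
      a∙b≡sum = cong (a ∙_) (sym (identityʳ b))
      collapse : w ∈ a ∷ b ∷ [] → a ≡ b
      collapse (here refl)         = cancel a b (trans (cong (a ∙_) a∙b≡sum) w∙ab≡ε)
      collapse (there (here refl)) = sym (cancel b a (trans (cong (b ∙_) (trans (comm b a) a∙b≡sum)) w∙ab≡ε))

open FinAbGroupSum using (ContainsOwnSums)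

module Cyclic (n : ℕ) where

  _+ₘ_ : Fin (suc n) → Fin (suc n) → Fin (suc n)
  a +ₘ b = (toℕ a + toℕ b) mod suc n

  -ₘ_ : Fin (suc n) → Fin (suc n)
  -ₘ a = (suc n ∸ toℕ a) mod suc n

  toℕ-mod : ∀ m → toℕ (m mod suc n) ≡ m % suc n
  toℕ-mod m = toℕ-fromℕ< (m%n<n m (suc n))

  toℕ-+ₘ : ∀ a b → toℕ (a +ₘ b) ≡ (toℕ a + toℕ b) % suc n
  toℕ-+ₘ a b = toℕ-mod (toℕ a + toℕ b)

  %-absorbˡ : ∀ a b → (a % suc n + b) % suc n ≡ (a + b) % suc n
  %-absorbˡ a b = begin
    (a % suc n + b) % suc n                  ≡⟨ %-distribˡ-+ (a % suc n) b (suc n) ⟩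
    (a % suc n % suc n + b % suc n) % suc n  ≡⟨ cong (λ x → (x + b % suc n) % suc n) (m%n%n≡m%n a (suc n)) ⟩
    (a % suc n + b % suc n) % suc n          ≡⟨ %-distribˡ-+ a b (suc n) ⟨
    (a + b) % suc n                          ∎

  %-absorbʳ : ∀ a b → (a + b % suc n) % suc n ≡ (a + b) % suc n
  %-absorbʳ a b = begin
    (a + b % suc n) % suc n ≡⟨ cong (_% suc n) (+-comm a (b % suc n)) ⟩
    (b % suc n + a) % suc n ≡⟨ %-absorbˡ b a ⟩
    (b + a) % suc n         ≡⟨ cong (_% suc n) (+-comm b a) ⟩
    (a + b) % suc n         ∎

  +ₘ-comm : ∀ a b → a +ₘ b ≡ b +ₘ a
  +ₘ-comm a b = cong (_mod suc n) (+-comm (toℕ a) (toℕ b))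

  +ₘ-assoc : ∀ a b c → (a +ₘ b) +ₘ c ≡ a +ₘ (b +ₘ c)
  +ₘ-assoc a b c = toℕ-injective (begin
    toℕ ((a +ₘ b) +ₘ c)                       ≡⟨ toℕ-+ₘ (a +ₘ b) c ⟩
    (toℕ (a +ₘ b) + toℕ c) % suc n            ≡⟨ cong (λ x → (x + toℕ c) % suc n) (toℕ-+ₘ a b) ⟩
    ((toℕ a + toℕ b) % suc n + toℕ c) % suc n ≡⟨ %-absorbˡ (toℕ a + toℕ b) (toℕ c) ⟩
    (toℕ a + toℕ b + toℕ c) % suc n           ≡⟨ cong (_% suc n) (+-assoc (toℕ a) (toℕ b) (toℕ c)) ⟩
    (toℕ a + (toℕ b + toℕ c)) % suc n         ≡⟨ %-absorbʳ (toℕ a) (toℕ b + toℕ c) ⟨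
    (toℕ a + (toℕ b + toℕ c) % suc n) % suc n ≡⟨ cong (λ x → (toℕ a + x) % suc n) (toℕ-+ₘ b c) ⟨
    (toℕ a + toℕ (b +ₘ c)) % suc n            ≡⟨ toℕ-+ₘ a (b +ₘ c) ⟨
    toℕ (a +ₘ (b +ₘ c))                       ∎)

  +ₘ-identityˡ : ∀ a → zero +ₘ a ≡ a
  +ₘ-identityˡ a = toℕ-injective (trans (toℕ-mod (toℕ a)) (m<n⇒m%n≡m (toℕ<n a)))

  +ₘ-identityʳ : ∀ a → a +ₘ zero ≡ a
  +ₘ-identityʳ a = trans (+ₘ-comm a zero) (+ₘ-identityˡ a)

  +ₘ-inverseˡ : ∀ a → (-ₘ a) +ₘ a ≡ zero
  +ₘ-inverseˡ a = toℕ-injective (begin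
    toℕ ((-ₘ a) +ₘ a)                              ≡⟨ toℕ-+ₘ (-ₘ a) a ⟩
    (toℕ (-ₘ a) + toℕ a) % suc n                   ≡⟨ cong (λ x → (x + toℕ a) % suc n) (toℕ-mod (suc n ∸ toℕ a)) ⟩
    ((suc n ∸ toℕ a) % suc n + toℕ a) % suc n      ≡⟨ %-absorbˡ (suc n ∸ toℕ a) (toℕ a) ⟩
    (suc n ∸ toℕ a + toℕ a) % suc n                ≡⟨ cong (_% suc n) (m∸n+n≡m (<⇒≤ (toℕ<n a))) ⟩
    suc n % suc n                                  ≡⟨ n%n≡0 (suc n) ⟩
    0                                              ∎)

  isAbelianGroup : IsAbelianGroup _≡_ _+ₘ_ zero -ₘ_
  isAbelianGroup = record
    { isGroup = record
      { isMonoid = record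
        { isSemigroup = record
          { isMagma = record { isEquivalence = isEquivalence ; ∙-cong = cong₂ _+ₘ_ }
          ; assoc   = +ₘ-assoc }
        ; identity = +ₘ-identityˡ , +ₘ-identityʳ }
      ; inverse = +ₘ-inverseˡ , λ a → trans (+ₘ-comm a (-ₘ a)) (+ₘ-inverseˡ a)
      ; ⁻¹-cong = cong -ₘ_ }
    ; comm = +ₘ-comm }

  ℤ/ : FinAbGroup (suc n)
  ℤ/ = record { _∙_ = _+ₘ_ ; ε = zero ; _⁻¹ = -ₘ_ ; isAbelianGroup = isAbelianGroup }

  open FinAbGroupSum ℤ/ using (sum; total; containsOwnSums-viaComplements)

  toℕ-sum : ∀ xs → toℕ (sum xs) ≡ sumℕ (map toℕ xs) % suc n
  toℕ-sum []       = refl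
  toℕ-sum (x ∷ xs) = begin
    toℕ (x +ₘ sum xs)                                ≡⟨ toℕ-+ₘ x (sum xs) ⟩
    (toℕ x + toℕ (sum xs)) % suc n                   ≡⟨ cong (λ s → (toℕ x + s) % suc n) (toℕ-sum xs) ⟩
    (toℕ x + sumℕ (map toℕ xs) % suc n) % suc n      ≡⟨ %-absorbʳ (toℕ x) (sumℕ (map toℕ xs)) ⟩
    (toℕ x + sumℕ (map toℕ xs)) % suc n              ∎

  toℕ-total : ∀ m → suc n ≡ 2 * suc m → toℕ total ≡ suc m
  toℕ-total m 1+n≡2[1+m] = begin
    toℕ total                                  ≡⟨ toℕ-sum (allFin (suc n)) ⟩
    sumℕ (map toℕ (allFin (suc n))) % suc n    ≡⟨ cong (λ xs → sumℕ xs % suc n) (map-toℕ-allFin (suc n)) ⟩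
    sumℕ (upTo (suc n)) % suc n                ≡⟨ cong (λ k → sumℕ (upTo k) % suc n) 1+n≡2[1+m] ⟩
    sumℕ (upTo (2 * suc m)) % suc n            ≡⟨ cong (_% suc n) (sumℕ-upTo-even m) ⟩
    (suc m + m * (2 * suc m)) % suc n          ≡⟨ cong (λ k → (suc m + m * k) % suc n) 1+n≡2[1+m] ⟨
    (suc m + m * suc n) % suc n                ≡⟨ [m+kn]%n≡m%n (suc m) m (suc n) ⟩
    suc m % suc n                              ≡⟨ m<n⇒m%n≡m (subst (suc m <_) (sym 1+n≡2[1+m]) (m<m+n (suc m) (s≤s z≤n))) ⟩
    suc m                                      ∎

  double≢total : ∀ b → suc n ≡ 2 * suc (2 * b) → ∀ c → c +ₘ c ≢ total
  double≢total b 1+n≡ c c+c≡total = even≢odd (toℕ c) (b + q * suc (2 * b)) (begin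
    2 * toℕ c                              ≡⟨ double (toℕ c) ⟩
    toℕ c + toℕ c                          ≡⟨ m≡m%n+[m/n]*n (toℕ c + toℕ c) (suc n) ⟩
    (toℕ c + toℕ c) % suc n + q * suc n    ≡⟨ cong (_+ q * suc n) (trans (sym (toℕ-+ₘ c c)) (cong toℕ c+c≡total)) ⟩
    toℕ total + q * suc n                  ≡⟨ cong (_+ q * suc n) (toℕ-total (2 * b) 1+n≡) ⟩
    suc (2 * b) + q * suc n                ≡⟨ cong (λ k → suc (2 * b) + q * k) 1+n≡ ⟩
    suc (2 * b) + q * (2 * suc (2 * b))    ≡⟨ odd b q ⟩
    suc (2 * (b + q * suc (2 * b)))        ∎)
    where
    q = (toℕ c + toℕ c) / suc n
    double : ∀ x → 2 * x ≡ x + x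
    double = solve-∀
    odd : ∀ b q → suc (2 * b) + q * (2 * suc (2 * b)) ≡ suc (2 * (b + q * suc (2 * b)))
    odd = solve-∀

  containsOwnSums-cyclic : ∀ b → suc n ≡ 2 * suc (2 * b) → ContainsOwnSums ℤ/ n
  containsOwnSums-cyclic b 1+n≡ = containsOwnSums-viaComplements λ ys _ n+ys≡1+n w w∙ys≡total w∈ys →
    let ys≡[w] = length≡1⇒≡[x] (+-cancelˡ-≡ n _ 1 (trans n+ys≡1+n (+-comm 1 n))) w∈ys
    in double≢total b 1+n≡ w (begin
      w +ₘ w            ≡⟨ cong (w +ₘ_) (+ₘ-identityʳ w) ⟨
      w +ₘ sum [ w ]    ≡⟨ cong (λ ys → w +ₘ sum ys) ys≡[w] ⟨
      w +ₘ sum ys       ≡⟨ w∙ys≡total ⟩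
      total             ∎)

module DirectProduct {a b : ℕ} (A : FinAbGroup a) (B : FinAbGroup b) where
  private
    module A = FinAbGroup A
    module B = FinAbGroup B
    module LA = IsAbelianGroup A.isAbelianGroup
    module LB = IsAbelianGroup B.isAbelianGroup

  pair : Fin (a * b) → Fin a × Fin b
  pair = remQuot b

  unpair : Fin a × Fin b → Fin (a * b)
  unpair = uncurry combine

  pair-unpair : ∀ p → pair (unpair p) ≡ p
  pair-unpair (x , y) = remQuot-combine x y

  unpair-pair : ∀ z → unpair (pair z) ≡ z
  unpair-pair = combine-remQuot {a} b

  _⊗_ : Fin a × Fin b → Fin a × Fin b → Fin a × Fin b
  (x , y) ⊗ (x′ , y′) = x A.∙ x′ , y B.∙ y′

  _∙_ : Fin (a * b) → Fin (a * b) → Fin (a * b)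
  z ∙ z′ = unpair (pair z ⊗ pair z′)

  ε : Fin (a * b)
  ε = unpair (A.ε , B.ε)

  _⁻¹ : Fin (a * b) → Fin (a * b)
  z ⁻¹ = unpair (proj₁ (pair z) A.⁻¹ , proj₂ (pair z) B.⁻¹)

  ∙-assoc : ∀ x y z → (x ∙ y) ∙ z ≡ x ∙ (y ∙ z)
  ∙-assoc x y z = begin
    unpair (pair (unpair (pair x ⊗ pair y)) ⊗ pair z) ≡⟨ cong (λ p → unpair (p ⊗ pair z)) (pair-unpair _) ⟩
    unpair ((pair x ⊗ pair y) ⊗ pair z)               ≡⟨ cong unpair (cong₂ _,_ (LA.assoc _ _ _) (LB.assoc _ _ _)) ⟩
    unpair (pair x ⊗ (pair y ⊗ pair z))               ≡⟨ cong (λ p → unpair (pair x ⊗ p)) (pair-unpair _) ⟨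
    unpair (pair x ⊗ pair (unpair (pair y ⊗ pair z))) ∎

  ∙-comm : ∀ x y → x ∙ y ≡ y ∙ x
  ∙-comm x y = cong unpair (cong₂ _,_ (LA.comm _ _) (LB.comm _ _))

  ∙-identityˡ : ∀ x → ε ∙ x ≡ x
  ∙-identityˡ x = begin
    unpair (pair (unpair (A.ε , B.ε)) ⊗ pair x) ≡⟨ cong (λ p → unpair (p ⊗ pair x)) (pair-unpair _) ⟩
    unpair ((A.ε , B.ε) ⊗ pair x)               ≡⟨ cong unpair (cong₂ _,_ (LA.identityˡ _) (LB.identityˡ _)) ⟩
    unpair (pair x)                             ≡⟨ unpair-pair x ⟩
    x                                           ∎

  ∙-inverseˡ : ∀ x → (x ⁻¹) ∙ x ≡ ε
  ∙-inverseˡ x = trans (cong (λ p → unpair (p ⊗ pair x)) (pair-unpair _))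
                       (cong unpair (cong₂ _,_ (LA.inverseˡ _) (LB.inverseˡ _)))

  isAbelianGroup : IsAbelianGroup _≡_ _∙_ ε _⁻¹
  isAbelianGroup = record
    { isGroup = record
      { isMonoid = record
        { isSemigroup = record
          { isMagma = record { isEquivalence = isEquivalence ; ∙-cong = cong₂ _∙_ }
          ; assoc   = ∙-assoc }
        ; identity = ∙-identityˡ , λ x → trans (∙-comm x ε) (∙-identityˡ x) }
      ; inverse = ∙-inverseˡ , λ x → trans (∙-comm x (x ⁻¹)) (∙-inverseˡ x)
      ; ⁻¹-cong = cong _⁻¹ }
    ; comm = ∙-comm }

  A×B : FinAbGroup (a * b)
  A×B = record { _∙_ = _∙_ ; ε = ε ; _⁻¹ = _⁻¹ ; isAbelianGroup = isAbelianGroup }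

  exponent3 : Exponent3 A → Exponent3 B → Exponent3 A×B
  exponent3 cubeA cubeB x = begin
    unpair (pair x ⊗ pair (unpair (pair x ⊗ pair x))) ≡⟨ cong (λ p → unpair (pair x ⊗ p)) (pair-unpair _) ⟩
    unpair (pair x ⊗ (pair x ⊗ pair x))               ≡⟨ cong unpair (cong₂ _,_ (cubeA _) (cubeB _)) ⟩
    ε                                                 ∎

ℤ/3^ : ∀ t → FinAbGroup (3 ^ t)
ℤ/3^ zero    = Cyclic.ℤ/ 0
ℤ/3^ (suc t) = DirectProduct.A×B (Cyclic.ℤ/ 2) (ℤ/3^ t)

ℤ/3^-exponent3 : ∀ t → Exponent3 (ℤ/3^ t)
ℤ/3^-exponent3 zero    zero = refl
ℤ/3^-exponent3 (suc t)      = DirectProduct.exponent3 (Cyclic.ℤ/ 2) (ℤ/3^ t) ℤ/3-exponent3 (ℤ/3^-exponent3 t)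
  where
  ℤ/3-exponent3 : Exponent3 (Cyclic.ℤ/ 2)
  ℤ/3-exponent3 zero             = refl
  ℤ/3-exponent3 (suc zero)       = refl
  ℤ/3-exponent3 (suc (suc zero)) = refl

module TwinEdgeColoring {n k : ℕ} (T : Graph n) (A : FinAbGroup k)
                         (f : Fin n → Fin n → Fin k) (twin : IsTwinEdgeColoring T A f) where
  open FinAbGroup A
  open FinAbGroupSum A using (sum)
  open IsAbelianGroup isAbelianGroup using (identityˡ; identityʳ)

  neighbours : Fin n → List (Fin n)
  neighbours v = filterᵇ (adj T v) (allFin n)

  ∈-neighbours⁻ : ∀ {v u} → u ∈ neighbours v → Adj T v u
  ∈-neighbours⁻ {v} u∈ = Equivalence.to T-≡ (proj₂ (∈-filter⁻ (T? ∘ adj T v) {xs = allFin n} u∈))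

  ∈-neighbours⁺ : ∀ {v u} → Adj T v u → u ∈ neighbours v
  ∈-neighbours⁺ {v} {u} vu = ∈-filter⁺ (T? ∘ adj T v) (∈-allFin u) (Equivalence.from T-≡ vu)

  labels : Fin n → List (Fin k)
  labels v = map (f v) (neighbours v)

  labels-unique : ∀ v → Unique (labels v)
  labels-unique v = map⁺-injectiveOn (f v)
    (λ u∈ u′∈ → proj₁ (proj₂ twin) v _ _ (∈-neighbours⁻ u∈) (∈-neighbours⁻ u′∈))
    (Unique.filter⁺ _ (Unique.allFin⁺ n))

  weight≡sum-labels : ∀ v → weight T A f v ≡ sum (labels v)
  weight≡sum-labels v = go (allFin n)
    where
    go : ∀ us → foldr (λ u acc → (if adj T v u then f v u else ε) ∙ acc) ε us
              ≡ sum (map (f v) (filterᵇ (adj T v) us))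
    go []       = refl
    go (u ∷ us) with adj T v u
    ... | true  = cong (f v u ∙_) (go us)
    ... | false = trans (identityˡ _) (go us)

  leaf-weight : ∀ {u v} → degree T u ≡ 1 → Adj T u v → weight T A f u ≡ f u v
  leaf-weight {u} {v} leaf uv = begin
    weight T A f u         ≡⟨ weight≡sum-labels u ⟩
    sum (labels u)         ≡⟨ cong (sum ∘ map (f u)) (length≡1⇒≡[x] leaf (∈-neighbours⁺ uv)) ⟩
    f u v ∙ ε              ≡⟨ identityʳ (f u v) ⟩
    f u v                  ∎

  module _ {Δ : ℕ} (ownSums : ContainsOwnSums A Δ)
           (nonLeaf : ∀ v → degree T v ≢ 1 → degree T v ≡ Δ) where

    Full : Fin n → Set
    Full v = degree T v ≡ Δ

    -- The label w(v) sits on an edge vu; u is no leaf, since a leaf's weight is its only label.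
    fullNeighbour : ∀ v → Full v → Σ (Σ (Fin n) Full) λ (u , _) → Adj T v u × f v u ≡ weight T A f v
    fullNeighbour v full
      with u , u∈ , w≡fvu ← ∈-map⁻ (f v) (subst (_∈ labels v) (sym (weight≡sum-labels v))
                                          (ownSums (labels v) (labels-unique v) (trans (length-map (f v) (neighbours v)) full)))
      with vu ← ∈-neighbours⁻ u∈
      = (u , nonLeaf u notLeaf) , vu , sym w≡fvu
      where
      notLeaf : degree T u ≢ 1
      notLeaf leaf = proj₂ (proj₂ twin) v u vu (trans w≡fvu (trans (proj₁ twin v u vu) (sym (leaf-weight leaf (trans (adj-sym T u v) vu)))))

    successor : Σ (Fin n) Full → Σ (Fin n) Full
    successor (v , full) = proj₁ (fullNeighbour v full)

    successor-adj : ∀ x → Adj T (proj₁ x) (proj₁ (successor x))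
    successor-adj (v , full) = proj₁ (proj₂ (fullNeighbour v full))

    successor-label : ∀ x → f (proj₁ x) (proj₁ (successor x)) ≡ weight T A f (proj₁ x)
    successor-label (v , full) = proj₂ (proj₂ (fullNeighbour v full))

    successor-noBacktrack : ∀ x → proj₁ (successor (successor x)) ≢ proj₁ x
    successor-noBacktrack x back = proj₂ (proj₂ twin) v u (successor-adj x) (begin
      weight T A f v        ≡⟨ successor-label x ⟨
      f v u                 ≡⟨ proj₁ twin v u (successor-adj x) ⟩
      f u v                 ≡⟨ cong (f u) back ⟨
      f u (proj₁ (successor (successor x))) ≡⟨ successor-label (successor x) ⟩
      weight T A f u        ∎)
      where
      v = proj₁ x
      u = proj₁ (successor x)

    walk : Σ (Fin n) Full → ℕ → Σ (Fin n) Full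
    walk x zero    = x
    walk x (suc t) = successor (walk x t)

    walk-nonBacktracking : ∀ x → NonBacktrackingWalk T (proj₁ ∘ walk x)
    walk-nonBacktracking x t = successor-adj (walk x t) , successor-noBacktrack (walk x t)

noTwinEdgeColoring : ∀ {n k Δ} (T : Graph n) (A : FinAbGroup k) → Acyclic T →
                     (∀ v → degree T v ≢ 1 → degree T v ≡ Δ) → ∀ v₀ → degree T v₀ ≡ Δ →
                     ContainsOwnSums A Δ → ¬ HasTwinEdgeColoring T A
noTwinEdgeColoring T A acyclic nonLeaf v₀ full ownSums (f , twin) =
  acyclic⇒¬nonBacktrackingWalk T acyclic _ (walk-nonBacktracking ownSums nonLeaf (v₀ , full))
  where open TwinEdgeColoring T A f twin

3^[2p+3]∸2-shape : ∀ p {Δ} → Δ ≡ 3 ^ (2 * suc p + 1) ∸ 2 →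
                   Δ ≢ 1 × (∃[ b ] suc Δ ≡ 2 * suc (2 * b)) × (∃[ t ] 2 + Δ ≡ 3 ^ t)
3^[2p+3]∸2-shape p Δ≡ with q , 3^≡ ← 3^[2p+3]≡3+4[1+q] p
  with refl ← trans Δ≡ (cong (_∸ 2) 3^≡)
  = (λ ()) , (suc q , arithmetic q) , (2 * suc p + 1 , sym 3^≡)
  where
  arithmetic : ∀ q → 2 + 4 * suc q ≡ 2 * suc (2 * suc q)
  arithmetic = solve-∀

groupWithOwnSums : ∀ {Δ k} → (∃[ b ] suc Δ ≡ 2 * suc (2 * b)) → (∃[ t ] 2 + Δ ≡ 3 ^ t) →
                   0 < k → k ≤ 2 + Δ → Σ (FinAbGroup k) λ A → ContainsOwnSums A Δ
groupWithOwnSums {Δ} {suc k} (b , 1+Δ≡) (t , 2+Δ≡) _ (s≤s k≤1+Δ) with <-cmp k Δ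
... | tri< k<Δ _ _ = Cyclic.ℤ/ k , FinAbGroupSum.containsOwnSums-≥order (Cyclic.ℤ/ k) k<Δ
... | tri≈ _ refl _ = Cyclic.ℤ/ Δ , Cyclic.containsOwnSums-cyclic Δ b 1+Δ≡
... | tri> _ _ Δ<k = subst (λ k → Σ (FinAbGroup k) λ A → ContainsOwnSums A Δ)
                           (trans (sym 2+Δ≡) (cong suc (≤-antisym Δ<k k≤1+Δ)))
                           (ℤ/3^ t , FinAbGroupSum.containsOwnSums-exponent3 (ℤ/3^ t) (ℤ/3^-exponent3 t) (trans (+-comm Δ 2) 2+Δ≡))

mainTheorem4 : ∀ (n : ℕ) (T : Graph n) (r p : ℕ) →
    7 ≤ n → IsRegularTree T r → 1 ≤ p →
    maxDegree T ≡ 3 ^ (2 * p + 1) ∸ 2 →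
    ∀ (χ : ℕ) → IsGroupTwinChromaticIndex T χ → maxDegree T + 3 ≤ χ
mainTheorem4 zero    _ _ _       () _ _
mainTheorem4 (suc n) _ _ zero    _  _ ()
mainTheorem4 (suc n) T r (suc p) _ (_ , (_ , acyclic) , regular) _ Δ≡ χ (2≤χ , colorable , _)
  with Δ≢1 , 1+Δ-twiceOdd , 2+Δ-power3 ← 3^[2p+3]∸2-shape p Δ≡
  with v₀ , full ← maxDegree-attained T
  = ≮⇒≥ λ χ<Δ+3 →
      let A , ownSums = groupWithOwnSums 1+Δ-twiceOdd 2+Δ-power3 (≤-trans (s≤s z≤n) 2≤χ)
                                                                (≤-pred (subst (suc χ ≤_) (+-comm (maxDegree T) 3) χ<Δ+3))
      in noTwinEdgeColoring T A acyclic nonLeaf v₀ full ownSums (colorable A)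
  where
  nonLeaf : ∀ v → degree T v ≢ 1 → degree T v ≡ maxDegree T
  nonLeaf v notLeaf = trans (regular v notLeaf) (trans (sym (regular v₀ (Δ≢1 ∘ trans (sym full)))) full)
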